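{- Let $(X,A_\tau,\rightarrow)$ be a labelled transition system. For all states $q,p$: if $q\mathrel{\#_{sb}} p$ then $q\mathrel{\#_b} p$.
   Context: An LTS is a triple $(X,A_\tau,\rightarrow)$ with $X$ a set of states, $A_\tau=A\cup\{\tau\}$ where $\tau\notin A$ is the silent action, and $\rightarrow\subseteq X\times A_\tau\times X$; write $q\rightarrow_u q'$ for $(q,u,q')\in\rightarrow$. The letter $a$ ranges over $A$. $\twoheadrightarrow_\tau$ is the reflexive-transitive closure of $\rightarrow_\tau$. Rules on a relation $Q\subseteq X\times X$: (symm) $Q(p,q)\Rightarrow Q(q,p)$; (in$_{b\tau}$) if $q\rightarrow_\tau q'$, $Q(q',p)$, and for all $p',p''$ with $p\twoheadrightarrow_\tau p'\rightarrow_\tau p''$ we have $Q(q,p')\vee Q(q',p'')$, then $Q(q,p)$; (in$_{sb\tau}$) if $q\rightarrow_\tau q'$, $Q(q',p)$, and for all $p',p''$ with $p\twoheadrightarrow_\tau p'\rightarrow_\tau p''$ we have $Q(q',p'')\vee(Q(q,p')\wedge Q(q,p''))$, then $Q(q,p)$; (in$_b$) for each $a\in A$: if $q\rightarrow_a q'$ and for all $p',p''$ with $p\twoheadrightarrow_\tau p'\rightarrow_a p''$ we have $Q(q,p')\vee Q(q',p'')$, then $Q(q,p)$. $Q$ is a branching apartness if it satisfies (symm), (in$_{b\tau}$), (in$_b$); a semi-branching apartness if it satisfies (symm), (in$_{sb\tau}$), (in$_b$). $q\mathrel{\#_b}p$ (resp. $q\mathrel{\#_{sb}}p$) means $Q(q,p)$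 for every branching (resp. semi-branching) apartness $Q$. -}

module Defs where

open import Data.Maybe using (Maybe; just; nothing)
open import Data.Product using (_×_)
open import Data.Sum using (_⊎_)
open import Relation.Binary.Construct.Closure.ReflexiveTransitive using (Star)

-- A labelled transition system (X, A_τ, →).  A_τ = A ∪ {τ} is modelled
-- as  Maybe A , with  nothing  playing the role of the silent action τ
-- (so τ ∉ A automatically).
record LTS : Set₁ where
  field
    X    : Set
    A    : Set
    step : X → Maybe A → X → Set

module _ (L : LTS) where
  open LTS L

  τstep : X → X → Set
  τstep q q' = step q nothing q'

  τsteps : X → X → Set
  τsteps = Star τstep

  Rel : Set₁
  Rel = X → X → Set

  Symm : Rel → Set
  Symm Q = ∀ {p q} → Q p q → Q q p

  InBτ : Rel → Set
  InBτ Q = ∀ {q q' p} → τstep q q' → Q q' p →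
           (∀ {p' p''} → τsteps p p' → τstep p' p'' → Q q p' ⊎ Q q' p'') →
           Q q p

  InSBτ : Rel → Set
  InSBτ Q = ∀ {q q' p} → τstep q q' → Q q' p →
            (∀ {p' p''} → τsteps p p' → τstep p' p'' →
               Q q' p'' ⊎ (Q q p' × Q q p'')) →
            Q q p

  InB : Rel → Set
  InB Q = ∀ (a : A) {q q' p} → step q (just a) q' →
          (∀ {p' p''} → τsteps p p' → step p' (just a) p'' → Q q p' ⊎ Q q' p'') →
          Q q p

  record IsBranchingApartness (Q : Rel) : Set where
    field
      symm : Symm Q
      inbτ : InBτ Q
      inb  : InB Q

  record IsSemiBranchingApartness (Q : Rel) : Set where
    field
      symm  : Symm Q
      insbτ : InSBτ Q
      inb   : InB Q

  _#b_ : X → X → Set₁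
  q #b p = ∀ (Q : Rel) → IsBranchingApartness Q → Q q p

  _#sb_ : X → X → Set₁
  q #sb p = ∀ (Q : Rel) → IsSemiBranchingApartness Q → Q q p

module Submission where

open import Data.Product using (_,_; _×_)
open import Data.Sum using (_⊎_; inj₁; inj₂)

open import Defs

module _ (L : LTS) where

  -- The side condition of (in_sbτ) entails that of (in_bτ), so a
  -- relation closed under (in_bτ) is closed under (in_sbτ).
  InBτ⇒InSBτ : ∀ {Q : Rel L} → InBτ L Q → InSBτ L Q
  InBτ⇒InSBτ {Q} inbτ q→q' q'Qp side =
    inbτ q→q' q'Qp (λ p↠p' p'→p'' → weaken (side p↠p' p'→p''))
    where
    weaken : ∀ {q q' p' p''} → Q q' p'' ⊎ (Q q p' × Q q p'') → Q q p' ⊎ Q q' p''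
    weaken (inj₁ q'Qp'')       = inj₂ q'Qp''
    weaken (inj₂ (qQp' , _)) = inj₁ qQp'

  isBranching⇒isSemiBranching : ∀ {Q : Rel L} →
    IsBranchingApartness L Q → IsSemiBranchingApartness L Q
  isBranching⇒isSemiBranching isB = record
    { symm  = symm
    ; insbτ = InBτ⇒InSBτ inbτ
    ; inb   = inb
    }
    where open IsBranchingApartness isB

lemma3p16 : (L : LTS) → ∀ (q p : LTS.X L) → _#sb_ L q p → _#b_ L q p
lemma3p16 L q p q#sbp Q isB = q#sbp Q (isBranching⇒isSemiBranching L isB)
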